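{- Let $n\ge1$ and let two $B$-diagonals have arc representations $\{[u_1,v_1-1],[u_1+n+1,v_1+n]\}$ and $\{[u_2,v_2-1],[u_2+n+1,v_2+n]\}$. These $B$-diagonals are noncrossing if and only if the sets $[u_1,v_1-1]\cup[u_1+n+1,v_1+n]$ and $[u_2,v_2-1]\cup[u_2+n+1,v_2+n]$ are nested (one contains the other) or disjoint.
   Context: Label the vertices of a regular $(2n+2)$-gon clockwise by $1,\ldots,n+1,\overline{1},\ldots,\overline{n+1}$, identify $\overline{i}$ with $n+1+i$, and read labels in $\mathbb{R}/(2n+2)\mathbb{Z}$. A $B$-diagonal is either a diameter $\{i,\overline{i}\}$ ($1\le i\le n+1$), or $\{\{i,j\},\{\overline{i},\overline{j}\}\}$ with $1\le i<i+1<j\le n+1$, or $\{\{i,\overline{j}\},\{\overline{i},j\}\}$ with $1\le j<i\le n+1$. Two $B$-diagonals cross if a diagonal of one and a diagonal of the other meet in the interior of the polygon. Every $B$-diagonal can be written as $\{\{u,v\},\{u+n+1,v+n+1\}\}$ with $v-u\equiv d\pmod{2n+2}$ for some $d\in\{2,\ldots,n+1\}$; its arc representation is the pair of closed arcs $\{[u,v-1],[u+n+1,v+n]\}$ on $\mathbb{R}/(2n+2)\mathbb{Z}$, where $[x,y]$ is the arc traversed increasingly from $x$ to $y$ (of length less than $n+1$). -}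

module Defs where

open import Data.Nat using (ℕ; zero; suc; _+_; _*_; _∸_; _≤_; _<_)
open import Data.Nat.DivMod using (_%_)
open import Data.Bool using (Bool; true; false)
open import Data.Product using (_×_; ∃)
open import Data.Sum using (_⊎_)
open import Data.Empty using (⊥)

-- Number of vertices of the polygon: 2n+2.  Vertex labels 1,…,n+1,1̄,…,n+1̄
-- are identified with 1,…,2n+2 and read modulo 2n+2, i.e. as elements
-- 0,…,2n+1 of ℕ (label 2n+2 ≡ 0).
N : ℕ → ℕ
N n = 2 + 2 * n

cdist : ℕ → ℕ → ℕ → ℕ
cdist n a x = (x + N n ∸ a) % N n

InOpen : ℕ → ℕ → ℕ → ℕ → Set
InOpen n a b x = (0 < cdist n a x) × (cdist n a x < cdist n a b)

-- Two diagonals {a,b} and {c,d} of the convex (2n+2)-gon meet in the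
-- interior of the polygon (transversally): their endpoints strictly interleave.
ChordsCross : ℕ → (ℕ × ℕ) → (ℕ × ℕ) → Set
ChordsCross n (a Data.Product., b) (c Data.Product., d) =
  (InOpen n a b c × InOpen n b a d) ⊎ (InOpen n a b d × InOpen n b a c)

-- The two diagonals {u,v},{u+n+1,v+n+1} (v = u+d) of the B-diagonal
-- with arc representation {[u,v-1],[u+n+1,v+n]}.
diag : ℕ → ℕ → ℕ → Bool → ℕ × ℕ
diag n u d false = (u % N n) Data.Product., ((u + d) % N n)
diag n u d true  = ((u + suc n) % N n) Data.Product., ((u + d + suc n) % N n)

BCross : ℕ → ℕ → ℕ → ℕ → ℕ → Set
BCross n u₁ d₁ u₂ d₂ = ∃ λ k → ∃ λ l → ChordsCross n (diag n u₁ d₁ k) (diag n u₂ d₂ l)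

-- Points of the circle ℝ/(2n+2)ℤ that matter: half-integers p/2,
-- encoded by p with p < 2N.  (Closed arcs with integer endpoints are
-- determined, for containment and disjointness, by these points.)
-- Point p/2 lies on the closed arc [a, a+L] (traversed increasingly).
InArc : ℕ → ℕ → ℕ → ℕ → Set
InArc n a L p = (p + 2 * N n ∸ 2 * (a % N n)) % (2 * N n) ≤ 2 * L

-- The set [u, v-1] ∪ [u+n+1, v+n] with v = u + d (arcs of length d-1).
ArcSet : ℕ → ℕ → ℕ → ℕ → Set
ArcSet n u d p = InArc n u (d ∸ 1) p ⊎ InArc n (u + suc n) (d ∸ 1) p

_⊆[_]_ : (ℕ → Set) → ℕ → (ℕ → Set) → Set
S ⊆[ n ] T = ∀ p → p < 2 * N n → S p → T p

Nested : ℕ → (ℕ → Set) → (ℕ → Set) → Set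
Nested n S T = (S ⊆[ n ] T) ⊎ (T ⊆[ n ] S)

Disjoint : ℕ → (ℕ → Set) → (ℕ → Set) → Set
Disjoint n S T = ∀ p → p < 2 * N n → S p → T p → ⊥

-- Measured clockwise from vertex u₁, and with the half-turn (n+1 vertices) factored out,
-- the second B-diagonal starts at some y ≤ n.  Rotating the polygon, the two B-diagonals
-- cross iff the chord {0, d₁} crosses {y, y + d₂} or {y + n + 1, y + n + 1 + d₂}.  Both
-- arc sets are invariant under the half-turn, so a point only matters through its position
-- on the circle folded by the half-turn (N half-units long), where the sets become the arcs
-- [0, 2(d₁-1)] and [2y, 2y + 2(d₂-1)].  A common case analysis on (d₁, d₂, y) shows that
-- the chords cross exactly when the second arc sticks out over the end of the first or
-- wraps around over its start, and exactly then the two arcs are neither nested nor disjoint.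
-- All distances are computed modulo N = 2n+2 via L = 2n+1 ≡ -1, which makes them linear.
module Submission where

open import Defs
open import Data.Bool using (Bool; true; false)
open import Data.Empty using (⊥)
open import Data.Nat using (ℕ; zero; suc; pred; _+_; _*_; _∸_; _≤_; _<_; z≤n; s≤s; s≤s⁻¹; z<s; NonZero; _<?_; _≤?_)
open import Data.Nat.DivMod
open import Data.Nat.Divisibility using (n∣m*n)
open import Data.Nat.Properties
open import Algebra.Properties.CommutativeSemigroup +-commutativeSemigroup using (xy∙z≈xz∙y)
open import Data.Nat.Tactic.RingSolver using (solve-∀)
open import Data.Product using (_×_; _,_; ∃)
open import Data.Product.Function.NonDependent.Propositional using (_×-⇔_)
open import Data.Sum using (_⊎_; inj₁; inj₂; swap)
open import Data.Sum.Function.Propositional using (_⊎-⇔_)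
open import Function.Base using (_∘_)
open import Function.Bundles using (_⇔_; mk⇔; Equivalence)
open import Function.Properties.Equivalence using () renaming (trans to ⇔-trans)
open import Function.Related.Propositional using (module EquationalReasoning; ≡⇒)
open import Relation.Binary.PropositionalEquality
open import Relation.Nullary using (¬_; yes; no; contradiction)

open Equivalence using (to; from)

module _ {m : ℕ} .{{_ : NonZero m}} where

  %-≡-by-multiples : ∀ {a b} k j → a + k * m ≡ b + j * m → a % m ≡ b % m
  %-≡-by-multiples {a} {b} k j a+km≡b+jm = begin
    a % m             ≡⟨ [m+kn]%n≡m%n a k m ⟨
    (a + k * m) % m   ≡⟨ cong (_% m) a+km≡b+jm ⟩
    (b + j * m) % m   ≡⟨ [m+kn]%n≡m%n b j m ⟩
    b % m             ∎
    where open ≡-Reasoning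

  [a%m+b]%m≡[a+b]%m : ∀ a b → (a % m + b) % m ≡ (a + b) % m
  [a%m+b]%m≡[a+b]%m a b = %-≡-by-multiples (a / m) 0 (begin
    a % m + b + a / m * m    ≡⟨ lemma (a % m) b (a / m * m) ⟩
    (a % m + a / m * m) + b  ≡⟨ cong (_+ b) (m≡m%n+[m/n]*n a m) ⟨
    a + b                    ≡⟨ +-identityʳ (a + b) ⟨
    a + b + 0 * m            ∎)
    where
    open ≡-Reasoning
    lemma : ∀ r b q → r + b + q ≡ (r + q) + b
    lemma = solve-∀

  [a+c*[b%m]]%m≡[a+c*b]%m : ∀ a c b → (a + c * (b % m)) % m ≡ (a + c * b) % m
  [a+c*[b%m]]%m≡[a+c*b]%m a c b = %-≡-by-multiples (c * (b / m)) 0 (begin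
    a + c * (b % m) + c * (b / m) * m  ≡⟨ lemma a c (b % m) (b / m) m ⟩
    a + c * (b % m + b / m * m)        ≡⟨ cong (λ t → a + c * t) (m≡m%n+[m/n]*n b m) ⟨
    a + c * b                          ≡⟨ +-identityʳ (a + c * b) ⟨
    a + c * b + 0 * m                  ∎)
    where
    open ≡-Reasoning
    lemma : ∀ a c r q m → a + c * r + c * q * m ≡ a + c * (r + q * m)
    lemma = solve-∀

[a+m∸x]%m≡[a+pred[m]*x]%m : ∀ {m} .{{_ : NonZero m}} a {x} → x ≤ m → (a + m ∸ x) % m ≡ (a + pred m * x) % m
[a+m∸x]%m≡[a+pred[m]*x]%m {suc l} a {x} x≤m = %-≡-by-multiples x 1 (begin
  (a + suc l ∸ x) + x * suc l    ≡⟨ lemma (a + suc l ∸ x) x l ⟩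
  ((a + suc l ∸ x) + x) + x * l  ≡⟨ cong (_+ x * l) (m∸n+n≡m (≤-trans x≤m (m≤n+m (suc l) a))) ⟩
  (a + suc l) + x * l            ≡⟨ lemma′ a x l ⟩
  (a + l * x) + 1 * suc l        ∎)
  where
  open ≡-Reasoning
  lemma : ∀ b x l → b + x * suc l ≡ (b + x) + x * l
  lemma = solve-∀
  lemma′ : ∀ a x l → (a + suc l) + x * l ≡ (a + l * x) + 1 * suc l
  lemma′ = solve-∀

x≤c⊎[x+m]%2m≤c⇔x%m≤c : ∀ {l x c} → c < suc l → x < 2 * suc l →
  (x ≤ c ⊎ (x + suc l) % (2 * suc l) ≤ c) ⇔ x % suc l ≤ c
x≤c⊎[x+m]%2m≤c⇔x%m≤c {l} {x} {c} c<m x<2m with x <? suc l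
... | yes x<m = mk⇔ to′ (inj₁ ∘ subst (_≤ c) x%m≡x)
  where
  x%m≡x : x % suc l ≡ x
  x%m≡x = m<n⇒m%n≡m x<m
  x+m%2m≡x+m : (x + suc l) % (2 * suc l) ≡ x + suc l
  x+m%2m≡x+m = m<n⇒m%n≡m (subst (x + suc l <_) (cong (suc l +_) (sym (+-identityʳ (suc l)))) (+-monoˡ-< (suc l) x<m))
  to′ : x ≤ c ⊎ (x + suc l) % (2 * suc l) ≤ c → x % suc l ≤ c
  to′ (inj₁ x≤c)   = subst (_≤ c) (sym x%m≡x) x≤c
  to′ (inj₂ x+m≤c) = contradiction (≤-trans (m≤n+m (suc l) x) (subst (_≤ c) x+m%2m≡x+m x+m≤c)) (<⇒≱ c<m)
... | no x≮m = mk⇔ to′ (inj₂ ∘ subst (_≤ c) (trans x%m≡t (sym x+m%2m≡t)))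
  where
  t = x ∸ suc l
  x%m≡t : x % suc l ≡ t
  x%m≡t = trans (sym (m≤n⇒[n∸m]%m≡n%m (≮⇒≥ x≮m)))
                (m<n⇒m%n≡m (m<n+o⇒m∸n<o x (suc l) (subst (x <_) (cong (suc l +_) (+-identityʳ (suc l))) x<2m)))
  x+m%2m≡t : (x + suc l) % (2 * suc l) ≡ t
  x+m%2m≡t = begin
    (x + suc l) % (2 * suc l)          ≡⟨ cong (λ v → (v + suc l) % (2 * suc l)) (m∸n+n≡m (≮⇒≥ x≮m)) ⟨
    (t + suc l + suc l) % (2 * suc l)  ≡⟨ cong (_% (2 * suc l)) (lemma t (suc l)) ⟩
    (t + 2 * suc l) % (2 * suc l)      ≡⟨ [m+n]%n≡m%n t (2 * suc l) ⟩
    t % (2 * suc l)                    ≡⟨ m<n⇒m%n≡m (≤-<-trans (m∸n≤m x (suc l)) x<2m) ⟩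
    t                                  ∎
    where
    open ≡-Reasoning
    lemma : ∀ t m → t + m + m ≡ t + 2 * m
    lemma = solve-∀
  to′ : x ≤ c ⊎ (x + suc l) % (2 * suc l) ≤ c → x % suc l ≤ c
  to′ (inj₁ x≤c)   = contradiction (≤-trans (≮⇒≥ x≮m) x≤c) (<⇒≱ c<m)
  to′ (inj₂ x+m≤c) = subst (_≤ c) (trans x+m%2m≡t (sym x%m≡t)) x+m≤c

m∸n≤o⇒m≤n+o : ∀ {m} n {o} → m ∸ n ≤ o → m ≤ n + o
m∸n≤o⇒m≤n+o {m} n m∸n≤o = ≤-trans (m≤n+m∸n m n) (+-monoʳ-≤ n m∸n≤o)

double-≤ : ∀ x z {w} → x + z ≤ w → 2 * x + 2 * z ≤ 2 * w
double-≤ x z {w} x+z≤w = subst (_≤ 2 * w) (*-distribˡ-+ 2 x z) (*-monoʳ-≤ 2 x+z≤w)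

-- Laminar and overlapping pairs of sets

_⊆⟨_⟩_ : (ℕ → Set) → ℕ → (ℕ → Set) → Set
S ⊆⟨ B ⟩ T = ∀ p → p < B → S p → T p

Laminar : ℕ → (ℕ → Set) → (ℕ → Set) → Set
Laminar B S T = ((S ⊆⟨ B ⟩ T) ⊎ (T ⊆⟨ B ⟩ S)) ⊎ (∀ p → p < B → S p → T p → ⊥)

Overlapping : ℕ → (ℕ → Set) → (ℕ → Set) → Set
Overlapping B S T =
  (∃ λ p → p < B × S p × T p) × (∃ λ p → p < B × S p × ¬ T p) × (∃ λ p → p < B × ¬ S p × T p)

Overlapping⇒¬Laminar : ∀ {B S T} → Overlapping B S T → ¬ Laminar B S T
Overlapping⇒¬Laminar (_ , (p , p<B , Sp , ¬Tp) , _) (inj₁ (inj₁ S⊆T)) = ¬Tp (S⊆T p p<B Sp)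
Overlapping⇒¬Laminar (_ , _ , (p , p<B , ¬Sp , Tp)) (inj₁ (inj₂ T⊆S)) = ¬Sp (T⊆S p p<B Tp)
Overlapping⇒¬Laminar ((p , p<B , Sp , Tp) , _)      (inj₂ S∩T≡∅)      = S∩T≡∅ p p<B Sp Tp

module _ {B B′ : ℕ} (f : ℕ → ℕ) {S T S′ T′ : ℕ → Set}
         (S⇔S′∘f : ∀ p → S p ⇔ S′ (f p)) (T⇔T′∘f : ∀ p → T p ⇔ T′ (f p)) where

  Laminar-pullback : (∀ p → f p < B′) → Laminar B′ S′ T′ → Laminar B S T
  Laminar-pullback f< (inj₁ (inj₁ S′⊆T′)) = inj₁ (inj₁ λ p _ → from (T⇔T′∘f p) ∘ S′⊆T′ (f p) (f< p) ∘ to (S⇔S′∘f p))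
  Laminar-pullback f< (inj₁ (inj₂ T′⊆S′)) = inj₁ (inj₂ λ p _ → from (S⇔S′∘f p) ∘ T′⊆S′ (f p) (f< p) ∘ to (T⇔T′∘f p))
  Laminar-pullback f< (inj₂ S′∩T′≡∅)      = inj₂ λ p _ Sp Tp → S′∩T′≡∅ (f p) (f< p) (to (S⇔S′∘f p) Sp) (to (T⇔T′∘f p) Tp)

  Overlapping-pullback : (∀ {q} → q < B′ → ∃ λ p → p < B × f p ≡ q) → Overlapping B′ S′ T′ → Overlapping B S T
  Overlapping-pullback onto ((q₁ , q₁< , S′q₁ , T′q₁) , (q₂ , q₂< , S′q₂ , ¬T′q₂) , (q₃ , q₃< , ¬S′q₃ , T′q₃))
    with onto q₁< | onto q₂< | onto q₃<
  ... | p₁ , p₁< , refl | p₂ , p₂< , refl | p₃ , p₃< , refl =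
    (p₁ , p₁< , from (S⇔S′∘f p₁) S′q₁ , from (T⇔T′∘f p₁) T′q₁) ,
    (p₂ , p₂< , from (S⇔S′∘f p₂) S′q₂ , ¬T′q₂ ∘ to (T⇔T′∘f p₂)) ,
    (p₃ , p₃< , ¬S′q₃ ∘ to (S⇔S′∘f p₃) , from (T⇔T′∘f p₃) T′q₃)

-- Clockwise distances on the (2n+2)-gon

-- N n ≡ suc (L n), so L n is -1 modulo N.
L : ℕ → ℕ
L n = suc (2 * n)

N≡2[1+n] : ∀ n → N n ≡ suc n + suc n
N≡2[1+n] n = lemma n
  where
  lemma : ∀ n → 2 + 2 * n ≡ suc n + suc n
  lemma = solve-∀

n<N : ∀ n → n < N n
n<N n = s≤s (≤-trans (m≤m+n n (n + 0)) (n≤1+n _))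

2n<N : ∀ n → 2 * n < N n
2n<N n = s≤s (n≤1+n (2 * n))

x+1+z<N : ∀ n {x z} → x ≤ n → z ≤ n → x + suc z < N n
x+1+z<N n {x} {z} x≤ z≤ = subst (x + suc z <_) (sym (N≡2[1+n] n)) (s≤s (+-mono-≤ x≤ (s≤s z≤)))

offset : ℕ → ℕ → ℕ → ℕ
offset n x z = (z + L n * x) % N n

cdist-% : ∀ n x z → cdist n (x % N n) (z % N n) ≡ offset n x z
cdist-% n x z = begin
  (z % N n + N n ∸ x % N n) % N n    ≡⟨ [a+m∸x]%m≡[a+pred[m]*x]%m (z % N n) (m%n≤n x (N n)) ⟩
  (z % N n + L n * (x % N n)) % N n  ≡⟨ [a+c*[b%m]]%m≡[a+c*b]%m (z % N n) (L n) x ⟩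
  (z % N n + L n * x) % N n          ≡⟨ [a%m+b]%m≡[a+b]%m z (L n * x) ⟩
  (z + L n * x) % N n                ∎
  where open ≡-Reasoning

cdist-0 : ∀ n {x} → x < N n → cdist n 0 x ≡ x
cdist-0 n {x} x<N = trans ([m+n]%n≡m%n x (N n)) (m<n⇒m%n≡m x<N)

cdist-≤ : ∀ n {d x} → d ≤ x → x < N n → cdist n d x ≡ x ∸ d
cdist-≤ n {d} {x} d≤x x<N = begin
  (x + N n ∸ d) % N n  ≡⟨ cong (_% N n) (+-∸-comm (N n) d≤x) ⟩
  (x ∸ d + N n) % N n  ≡⟨ [m+n]%n≡m%n (x ∸ d) (N n) ⟩
  (x ∸ d) % N n        ≡⟨ m<n⇒m%n≡m (≤-<-trans (m∸n≤m x d) x<N) ⟩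
  x ∸ d                ∎
  where open ≡-Reasoning

cdist-> : ∀ n {d x} → x < d → cdist n d x ≡ x + N n ∸ d
cdist-> n {d} {x} x<d = m<n⇒m%n≡m (m<n+o⇒m∸n<o (x + N n) d (+-monoˡ-< (N n) x<d))

offset-rotate : ∀ n s x z → offset n (x + s) (z + s) ≡ offset n x z
offset-rotate n s x z = %-≡-by-multiples 0 s (lemma z s x (L n))
  where
  lemma : ∀ z s x l → z + s + l * (x + s) + 0 * suc l ≡ z + l * x + s * suc l
  lemma = solve-∀

offset-+ʳ : ∀ n x z c → offset n x (z + c) ≡ (offset n x z + c) % N n
offset-+ʳ n x z c = begin
  (z + c + L n * x) % N n   ≡⟨ cong (_% N n) (xy∙z≈xz∙y z c (L n * x)) ⟩
  (z + L n * x + c) % N n   ≡⟨ [a%m+b]%m≡[a+b]%m (z + L n * x) c ⟨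
  (offset n x z + c) % N n  ∎
  where open ≡-Reasoning

-- L n * (n + 1) ≡ n + 1 modulo N.
offset-+ˡ-half-turn : ∀ n x z → offset n (x + suc n) z ≡ (offset n x z + suc n) % N n
offset-+ˡ-half-turn n x z = begin
  (z + L n * (x + suc n)) % N n  ≡⟨ %-≡-by-multiples 0 n (lemma z x n) ⟩
  (z + L n * x + suc n) % N n    ≡⟨ [a%m+b]%m≡[a+b]%m (z + L n * x) (suc n) ⟨
  (offset n x z + suc n) % N n   ∎
  where
  open ≡-Reasoning
  lemma : ∀ z x n → z + suc (2 * n) * (x + suc n) + 0 * (2 + 2 * n) ≡ z + suc (2 * n) * x + suc n + n * (2 + 2 * n)
  lemma = solve-∀

offset-reaches : ∀ n x z c → (offset n x z + c + x) % N n ≡ (z + c) % N n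
offset-reaches n x z c = begin
  (offset n x z + c + x) % N n    ≡⟨ cong (_% N n) (+-assoc (offset n x z) c x) ⟩
  (offset n x z + (c + x)) % N n  ≡⟨ [a%m+b]%m≡[a+b]%m (z + L n * x) (c + x) ⟩
  (z + L n * x + (c + x)) % N n   ≡⟨ %-≡-by-multiples 0 x (lemma z x c (L n)) ⟩
  (z + c) % N n                   ∎
  where
  open ≡-Reasoning
  lemma : ∀ z x c l → z + l * x + (c + x) + 0 * suc l ≡ z + c + x * suc l
  lemma = solve-∀

cdist-rotate : ∀ n s a c → cdist n ((a + s) % N n) ((c + s) % N n) ≡ cdist n (a % N n) (c % N n)
cdist-rotate n s a c = begin
  cdist n ((a + s) % N n) ((c + s) % N n)  ≡⟨ cdist-% n (a + s) (c + s) ⟩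
  offset n (a + s) (c + s)                 ≡⟨ offset-rotate n s a c ⟩
  offset n a c                             ≡⟨ cdist-% n a c ⟨
  cdist n (a % N n) (c % N n)              ∎
  where open ≡-Reasoning

InOpen-rotate : ∀ n s a b x →
  InOpen n ((a + s) % N n) ((b + s) % N n) ((x + s) % N n) ≡ InOpen n (a % N n) (b % N n) (x % N n)
InOpen-rotate n s a b x = cong₂ (λ δx δb → 0 < δx × δx < δb) (cdist-rotate n s a x) (cdist-rotate n s a b)

ChordsCross-rotate : ∀ n s a b c e →
  ChordsCross n ((a + s) % N n , (b + s) % N n) ((c + s) % N n , (e + s) % N n) ≡
  ChordsCross n (a % N n , b % N n) (c % N n , e % N n)
ChordsCross-rotate n s a b c e =
  cong₂ _⊎_ (cong₂ _×_ (InOpen-rotate n s a b c) (InOpen-rotate n s b a e))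
            (cong₂ _×_ (InOpen-rotate n s a b e) (InOpen-rotate n s b a c))

InOpen-from-0 : ∀ n {b x} → b < N n → x < N n → InOpen n 0 b x ≡ (0 < x × x < b)
InOpen-from-0 n b<N x<N = cong₂ (λ δx δb → 0 < δx × δx < δb) (cdist-0 n x<N) (cdist-0 n b<N)

InOpen-to-0 : ∀ n {b x} → 0 < b → x < N n → InOpen n b 0 x ⇔ b < x
InOpen-to-0 n {b} {x} 0<b x<N = mk⇔ to′ from′
  where
  δb0 : cdist n b 0 ≡ N n ∸ b
  δb0 = cdist-> n 0<b
  to′ : InOpen n b 0 x → b < x
  to′ (0<δ , δ<) with b <? x
  ... | yes b<x = b<x
  ... | no b≮x with m≤n⇒m<n∨m≡n (≮⇒≥ b≮x)
  ...   | inj₂ refl = contradiction (trans (cdist-≤ n ≤-refl x<N) (n∸n≡0 x)) (≢-sym (<⇒≢ 0<δ))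
  ...   | inj₁ x<b  = contradiction (subst₂ _<_ (cdist-> n x<b) δb0 δ<) (≤⇒≯ (∸-monoˡ-≤ b (m≤n+m (N n) x)))
  from′ : b < x → InOpen n b 0 x
  from′ b<x = subst (0 <_) (sym δbx) (m<n⇒0<n∸m b<x) ,
              subst₂ _<_ (sym δbx) (sym δb0) (∸-monoˡ-< x<N (<⇒≤ b<x))
    where δbx = cdist-≤ n (<⇒≤ b<x) x<N

Interleaved : ℕ → ℕ → ℕ → Set
Interleaved β γ ε = (0 < γ × γ < β) × β < ε ⊎ (0 < ε × ε < β) × β < γ

ChordsCross-0⇔Interleaved : ∀ n {β γ ε} → 0 < β → β < N n → γ < N n → ε < N n →
  ChordsCross n (0 , β) (γ , ε) ⇔ Interleaved β γ ε
ChordsCross-0⇔Interleaved n 0<β β<N γ<N ε<N =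
  (≡⇒ (InOpen-from-0 n β<N γ<N) ×-⇔ InOpen-to-0 n 0<β ε<N) ⊎-⇔
  (≡⇒ (InOpen-from-0 n β<N ε<N) ×-⇔ InOpen-to-0 n 0<β γ<N)

chord : ℕ → ℕ → ℕ → ℕ × ℕ
chord n x d = x % N n , (x + d) % N n

ChordsCross-chord⇔Interleaved : ∀ n x z {d₁} d₂ → 0 < d₁ → d₁ < N n →
  ChordsCross n (chord n x d₁) (chord n z d₂) ⇔ Interleaved d₁ (offset n x z) ((offset n x z + d₂) % N n)
ChordsCross-chord⇔Interleaved n x z {d₁} d₂ 0<d₁ d₁<N = begin
  ChordsCross n (chord n x d₁) (chord n z d₂)
    ≡⟨ cong₂ (ChordsCross n) (cong (λ t → x % N n , t % N n) (+-comm d₁ x))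
                             (cong₂ _,_ (trans (offset-reaches n x z 0) (cong (_% N n) (+-identityʳ z)))
                                        (offset-reaches n x z d₂)) ⟨
  ChordsCross n ((0 + x) % N n , (d₁ + x) % N n) ((w + 0 + x) % N n , (w + d₂ + x) % N n)
    ≡⟨ ChordsCross-rotate n x 0 d₁ (w + 0) (w + d₂) ⟩
  ChordsCross n (0 , d₁ % N n) ((w + 0) % N n , (w + d₂) % N n)
    ≡⟨ cong₂ (λ β γ → ChordsCross n (0 , β) (γ , (w + d₂) % N n))
             (m<n⇒m%n≡m d₁<N) (trans (cong (_% N n) (+-identityʳ w)) (m%n%n≡m%n (z + L n * x) (N n))) ⟩
  ChordsCross n (0 , d₁) (w , (w + d₂) % N n)
    ∼⟨ ChordsCross-0⇔Interleaved n 0<d₁ d₁<N (m%n<n (z + L n * x) (N n)) (m%n<n (w + d₂) (N n)) ⟩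
  Interleaved d₁ w ((w + d₂) % N n) ∎
  where
  open EquationalReasoning
  w = offset n x z

-- Crossing B-diagonals

turn : ℕ → Bool → ℕ → ℕ
turn n false u = u
turn n true  u = u + suc n

diag≡chord : ∀ n u d k → diag n u d k ≡ chord n (turn n k u) d
diag≡chord n u d false = refl
diag≡chord n u d true  = cong (λ t → (u + suc n) % N n , t % N n) (xy∙z≈xz∙y u d (suc n))

CrossAt : ℕ → ℕ → ℕ → ℕ → Set
CrossAt n d₁ d₂ w = Interleaved d₁ w ((w + d₂) % N n)

BCross⇔CrossAt : ∀ n u₁ {d₁} u₂ d₂ → 0 < d₁ → d₁ < N n →
  BCross n u₁ d₁ u₂ d₂ ⇔ (CrossAt n d₁ d₂ (offset n u₁ u₂) ⊎ CrossAt n d₁ d₂ ((offset n u₁ u₂ + suc n) % N n))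
BCross⇔CrossAt n u₁ {d₁} u₂ d₂ 0<d₁ d₁<N = mk⇔ to′ from′
  where
  crossing : ∀ k l → ChordsCross n (diag n u₁ d₁ k) (diag n u₂ d₂ l) ⇔
                     CrossAt n d₁ d₂ (offset n (turn n k u₁) (turn n l u₂))
  crossing k l = ⇔-trans (≡⇒ (cong₂ (ChordsCross n) (diag≡chord n u₁ d₁ k) (diag≡chord n u₂ d₂ l)))
                         (ChordsCross-chord⇔Interleaved n (turn n k u₁) (turn n l u₂) d₂ 0<d₁ d₁<N)
  to′ : BCross n u₁ d₁ u₂ d₂ → CrossAt n d₁ d₂ (offset n u₁ u₂) ⊎ CrossAt n d₁ d₂ ((offset n u₁ u₂ + suc n) % N n)
  to′ (false , false , c) = inj₁ (to (crossing false false) c)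
  to′ (true  , true  , c) = inj₁ (subst (CrossAt n d₁ d₂) (offset-rotate n (suc n) u₁ u₂) (to (crossing true true) c))
  to′ (false , true  , c) = inj₂ (subst (CrossAt n d₁ d₂) (offset-+ʳ n u₁ u₂ (suc n)) (to (crossing false true) c))
  to′ (true  , false , c) = inj₂ (subst (CrossAt n d₁ d₂) (offset-+ˡ-half-turn n u₁ u₂) (to (crossing true false) c))
  from′ : CrossAt n d₁ d₂ (offset n u₁ u₂) ⊎ CrossAt n d₁ d₂ ((offset n u₁ u₂ + suc n) % N n) → BCross n u₁ d₁ u₂ d₂
  from′ (inj₁ c) = false , false , from (crossing false false) c
  from′ (inj₂ c) = false , true  , from (crossing false true) (subst (CrossAt n d₁ d₂) (sym (offset-+ʳ n u₁ u₂ (suc n))) c)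

UpToHalfTurn : ℕ → ℕ → ℕ → Set
UpToHalfTurn n r y = r ≡ y ⊎ r ≡ y + suc n

half-turn-decomposition : ∀ n {r} → r < N n → ∃ λ y → y ≤ n × UpToHalfTurn n r y
half-turn-decomposition n {r} r<N with r <? suc n
... | yes r<1+n = r , s≤s⁻¹ r<1+n , inj₁ refl
... | no  r≮1+n = r ∸ suc n , s≤s⁻¹ (m<n+o⇒m∸n<o r (suc n) (subst (r <_) (N≡2[1+n] n) r<N)) ,
                  inj₂ (sym (m∸n+n≡m (≮⇒≥ r≮1+n)))

CrossAt-half-turns : ∀ n d₁ d₂ {r y} → y ≤ n → UpToHalfTurn n r y →
  (CrossAt n d₁ d₂ r ⊎ CrossAt n d₁ d₂ ((r + suc n) % N n)) ⇔ (CrossAt n d₁ d₂ y ⊎ CrossAt n d₁ d₂ (y + suc n))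
CrossAt-half-turns n d₁ d₂ {y = y} y≤n (inj₁ refl) =
  ≡⇒ (cong (λ t → CrossAt n d₁ d₂ y ⊎ CrossAt n d₁ d₂ t) (m<n⇒m%n≡m (x+1+z<N n y≤n ≤-refl)))
CrossAt-half-turns n d₁ d₂ {y = y} y≤n (inj₂ refl) =
  ⇔-trans (≡⇒ (cong (λ t → CrossAt n d₁ d₂ (y + suc n) ⊎ CrossAt n d₁ d₂ t) y+N%N≡y)) (mk⇔ swap swap)
  where
  y+N%N≡y : (y + suc n + suc n) % N n ≡ y
  y+N%N≡y = begin
    (y + suc n + suc n) % N n  ≡⟨ cong (_% N n) (trans (+-assoc y (suc n) (suc n)) (cong (y +_) (sym (N≡2[1+n] n)))) ⟩
    (y + N n) % N n            ≡⟨ [m+n]%n≡m%n y (N n) ⟩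
    y % N n                    ≡⟨ m<n⇒m%n≡m (≤-<-trans y≤n (n<N n)) ⟩
    y                          ∎
    where open ≡-Reasoning

-- With a = d₁ - 1 and b = d₂ - 1: on the folded circle the arc [2y, 2y + 2b] sticks out over
-- the end of the arc [0, 2a], resp. wraps around over its start.
OverlapsEnd : ℕ → ℕ → ℕ → Set
OverlapsEnd a b y = 0 < y × y ≤ a × a < y + b

OverlapsStart : ℕ → ℕ → ℕ → ℕ → Set
OverlapsStart n a b y = n < y + b × y + b ≤ n + a

OverlapsStart⇒0<y : ∀ {n a b y} → b ≤ n → OverlapsStart n a b y → 0 < y
OverlapsStart⇒0<y {b = b} {y} b≤n (n<y+b , _) = +-cancelʳ-< b 0 y (≤-<-trans b≤n n<y+b)

CrossAt⇔OverlapsEnd : ∀ n {a b y} → b ≤ n → y ≤ n → CrossAt n (suc a) (suc b) y ⇔ OverlapsEnd a b y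
CrossAt⇔OverlapsEnd n {a} {b} {y} b≤n y≤n =
  ⇔-trans (≡⇒ (cong (Interleaved (suc a) y) (m<n⇒m%n≡m (x+1+z<N n y≤n b≤n)))) (mk⇔ to′ from′)
  where
  to′ : Interleaved (suc a) y (y + suc b) → OverlapsEnd a b y
  to′ (inj₁ ((0<y , y<1+a) , 1+a<y+1+b)) = 0<y , s≤s⁻¹ y<1+a , s≤s⁻¹ (subst (suc a <_) (+-suc y b) 1+a<y+1+b)
  to′ (inj₂ ((_ , y+1+b<1+a) , 1+a<y))   = contradiction (<-trans y+1+b<1+a 1+a<y) (≤⇒≯ (m≤m+n y (suc b)))
  from′ : OverlapsEnd a b y → Interleaved (suc a) y (y + suc b)
  from′ (0<y , y≤a , a<y+b) = inj₁ ((0<y , s≤s y≤a) , subst (suc a <_) (sym (+-suc y b)) (s≤s a<y+b))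

CrossAt⇔OverlapsStart : ∀ n {a b y} → a ≤ n → b ≤ n → y ≤ n →
  CrossAt n (suc a) (suc b) (y + suc n) ⇔ OverlapsStart n a b y
CrossAt⇔OverlapsStart n {a} {b} {y} a≤n b≤n y≤n = mk⇔ to′ from′
  where
  e = y + suc n + suc b
  e≡y+b+2+n : e ≡ (y + b) + suc (suc n)
  e≡y+b+2+n = lemma y b n
    where
    lemma : ∀ y b n → y + suc n + suc b ≡ (y + b) + suc (suc n)
    lemma = solve-∀
  e≡[y+b∸n]+N : n < y + b → e ≡ (y + b ∸ n) + N n
  e≡[y+b∸n]+N n<y+b = begin
    e                              ≡⟨ e≡y+b+2+n ⟩
    (y + b) + suc (suc n)          ≡⟨ cong (_+ suc (suc n)) (m∸n+n≡m (<⇒≤ n<y+b)) ⟨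
    (y + b ∸ n) + n + suc (suc n)  ≡⟨ lemma (y + b ∸ n) n ⟩
    (y + b ∸ n) + N n              ∎
    where
    open ≡-Reasoning
    lemma : ∀ t n → t + n + suc (suc n) ≡ t + (2 + 2 * n)
    lemma = solve-∀
  e%N≡y+b∸n : n < y + b → e % N n ≡ y + b ∸ n
  e%N≡y+b∸n n<y+b = begin
    e % N n                  ≡⟨ cong (_% N n) (e≡[y+b∸n]+N n<y+b) ⟩
    (y + b ∸ n + N n) % N n  ≡⟨ [m+n]%n≡m%n (y + b ∸ n) (N n) ⟩
    (y + b ∸ n) % N n        ≡⟨ m<n⇒m%n≡m (≤-<-trans (m∸n≤m (y + b) n) (<-trans (+-monoʳ-< y (n<1+n b)) (x+1+z<N n y≤n b≤n))) ⟩
    y + b ∸ n                ∎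
    where open ≡-Reasoning
  e≤N : ¬ n < y + b → e ≤ N n
  e≤N n≮y+b = ≤-trans (≤-reflexive e≡y+b+2+n) (≤-trans (+-monoˡ-≤ (suc (suc n)) (≮⇒≥ n≮y+b)) (≤-reflexive (lemma n)))
    where
    lemma : ∀ n → n + suc (suc n) ≡ 2 + 2 * n
    lemma = solve-∀
  to′ : Interleaved (suc a) (y + suc n) (e % N n) → OverlapsStart n a b y
  to′ (inj₁ ((_ , y+1+n<1+a) , _)) = contradiction y+1+n<1+a (≤⇒≯ (≤-trans (s≤s a≤n) (m≤n+m (suc n) y)))
  to′ (inj₂ ((0<e%N , e%N<1+a) , _)) with n <? y + b
  ... | yes n<y+b = n<y+b , m∸n≤o⇒m≤n+o n (s≤s⁻¹ (subst (_< suc a) (e%N≡y+b∸n n<y+b) e%N<1+a))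
  ... | no  n≮y+b with m≤n⇒m<n∨m≡n (e≤N n≮y+b)
  ...   | inj₁ e<N = contradiction (subst (_< suc a) (m<n⇒m%n≡m e<N) e%N<1+a)
                                   (≤⇒≯ (≤-trans (s≤s a≤n) (≤-trans (m≤n+m (suc n) y) (m≤m+n (y + suc n) (suc b)))))
  ...   | inj₂ e≡N = contradiction (trans (cong (_% N n) e≡N) (n%n≡0 (N n))) (≢-sym (<⇒≢ 0<e%N))
  from′ : OverlapsStart n a b y → Interleaved (suc a) (y + suc n) (e % N n)
  from′ start@(n<y+b , y+b≤n+a) =
    inj₂ ((subst (0 <_) (sym (e%N≡y+b∸n n<y+b)) (m<n⇒0<n∸m n<y+b) ,
           subst (_< suc a) (sym (e%N≡y+b∸n n<y+b)) (s≤s (m≤n+o⇒m∸n≤o (y + b) n y+b≤n+a))) ,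
          ≤-<-trans (s≤s a≤n) (m<n+m (suc n) (OverlapsStart⇒0<y b≤n start)))

BCross⇔Overlaps : ∀ n u₁ u₂ {a b y} → a ≤ n → b ≤ n → y ≤ n → UpToHalfTurn n (offset n u₁ u₂) y →
  BCross n u₁ (suc a) u₂ (suc b) ⇔ (OverlapsEnd a b y ⊎ OverlapsStart n a b y)
BCross⇔Overlaps n u₁ u₂ a≤n b≤n y≤n r≈y =
  ⇔-trans (BCross⇔CrossAt n u₁ u₂ _ z<s (x+1+z<N n z≤n a≤n))
  (⇔-trans (CrossAt-half-turns n _ _ y≤n r≈y)
           (CrossAt⇔OverlapsEnd n b≤n y≤n ⊎-⇔ CrossAt⇔OverlapsStart n a≤n b≤n y≤n))

-- Arc sets on the circle folded by the half-turn

-- InArc n u L p unfolds to arcPos n u p ≤ 2 * L.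
arcPos : ℕ → ℕ → ℕ → ℕ
arcPos n u p = (p + 2 * N n ∸ 2 * (u % N n)) % (2 * N n)

arcPos≡ : ∀ n u p → arcPos n u p ≡ (p + (3 + 4 * n) * (2 * u)) % (2 * N n)
arcPos≡ n u p = begin
  (p + 2 * N n ∸ 2 * (u % N n)) % (2 * N n)           ≡⟨ [a+m∸x]%m≡[a+pred[m]*x]%m p (*-monoʳ-≤ 2 (m%n≤n u (N n))) ⟩
  (p + pred (2 * N n) * (2 * (u % N n))) % (2 * N n)  ≡⟨ cong (λ k → (p + k * (2 * (u % N n))) % (2 * N n)) (cong pred (lemma n)) ⟩
  (p + K * (2 * (u % N n))) % (2 * N n)               ≡⟨ %-≡-by-multiples (K * (u / N n)) 0 (begin
    p + K * (2 * (u % N n)) + K * (u / N n) * (2 * N n)  ≡⟨ lemma′ p K (u % N n) (u / N n) (N n) ⟩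
    p + K * (2 * (u % N n + u / N n * N n)) + 0 * (2 * N n)
        ≡⟨ cong (λ v → p + K * (2 * v) + 0 * (2 * N n)) (m≡m%n+[m/n]*n u (N n)) ⟨
    p + K * (2 * u) + 0 * (2 * N n)                      ∎) ⟩
  (p + K * (2 * u)) % (2 * N n)                       ∎
  where
  open ≡-Reasoning
  K = 3 + 4 * n
  lemma : ∀ n → 2 * (2 + 2 * n) ≡ 4 + 4 * n
  lemma = solve-∀
  lemma′ : ∀ p k r q m → p + k * (2 * r) + k * q * (2 * m) ≡ p + k * (2 * (r + q * m)) + 0 * (2 * m)
  lemma′ = solve-∀

arcPos-half-turn : ∀ n u p → arcPos n (u + suc n) p ≡ (arcPos n u p + N n) % (2 * N n)
arcPos-half-turn n u p = begin
  arcPos n (u + suc n) p                               ≡⟨ arcPos≡ n (u + suc n) p ⟩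
  (p + (3 + 4 * n) * (2 * (u + suc n))) % (2 * N n)    ≡⟨ %-≡-by-multiples 0 (L n) (lemma p u n) ⟩
  (p + (3 + 4 * n) * (2 * u) + N n) % (2 * N n)        ≡⟨ [a%m+b]%m≡[a+b]%m (p + (3 + 4 * n) * (2 * u)) (N n) ⟨
  ((p + (3 + 4 * n) * (2 * u)) % (2 * N n) + N n) % (2 * N n)
                                                       ≡⟨ cong (λ v → (v + N n) % (2 * N n)) (arcPos≡ n u p) ⟨
  (arcPos n u p + N n) % (2 * N n)                     ∎
  where
  open ≡-Reasoning
  lemma : ∀ p u n → p + (3 + 4 * n) * (2 * (u + suc n)) + 0 * (2 * (2 + 2 * n)) ≡
                    p + (3 + 4 * n) * (2 * u) + (2 + 2 * n) + suc (2 * n) * (2 * (2 + 2 * n))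
  lemma = solve-∀

foldedPos : ℕ → ℕ → ℕ → ℕ
foldedPos n u p = (p + L n * (2 * u)) % N n

arcPos-%N : ∀ n u p → arcPos n u p % N n ≡ foldedPos n u p
arcPos-%N n u p = begin
  arcPos n u p % N n                             ≡⟨ cong (_% N n) (arcPos≡ n u p) ⟩
  (p + (3 + 4 * n) * (2 * u)) % (2 * N n) % N n  ≡⟨ m∣n⇒o%n%m≡o%m (N n) (2 * N n) (p + (3 + 4 * n) * (2 * u)) (n∣m*n 2) ⟩
  (p + (3 + 4 * n) * (2 * u)) % N n              ≡⟨ %-≡-by-multiples 0 (2 * u) (lemma p u n) ⟩
  (p + L n * (2 * u)) % N n                      ∎
  where
  open ≡-Reasoning
  lemma : ∀ p u n → p + (3 + 4 * n) * (2 * u) + 0 * (2 + 2 * n) ≡ p + suc (2 * n) * (2 * u) + 2 * u * (2 + 2 * n)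
  lemma = solve-∀

ArcSet⇔foldedPos≤ : ∀ n u {d} p → d ≤ suc n → ArcSet n u d p ⇔ foldedPos n u p ≤ 2 * (d ∸ 1)
ArcSet⇔foldedPos≤ n u {d} p d≤1+n = begin
  ArcSet n u d p
    ≡⟨ cong (λ v → arcPos n u p ≤ c ⊎ v ≤ c) (arcPos-half-turn n u p) ⟩
  (arcPos n u p ≤ c ⊎ (arcPos n u p + N n) % (2 * N n) ≤ c)
    ∼⟨ x≤c⊎[x+m]%2m≤c⇔x%m≤c c<N (m%n<n (p + 2 * N n ∸ 2 * (u % N n)) (2 * N n)) ⟩
  arcPos n u p % N n ≤ c
    ≡⟨ cong (_≤ c) (arcPos-%N n u p) ⟩
  foldedPos n u p ≤ c ∎
  where
  open EquationalReasoning
  c = 2 * (d ∸ 1)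
  c<N : c < N n
  c<N = ≤-<-trans (*-monoʳ-≤ 2 (∸-monoˡ-≤ 1 d≤1+n)) (2n<N n)

foldedPos-surjective : ∀ n u {Z} → Z < N n → ∃ λ p → p < 2 * N n × foldedPos n u p ≡ Z
foldedPos-surjective n u {Z} Z<N = (Z + 2 * u) % (2 * N n) , m%n<n (Z + 2 * u) (2 * N n) , (begin
  ((Z + 2 * u) % (2 * N n) + L n * (2 * u)) % N n        ≡⟨ [a%m+b]%m≡[a+b]%m ((Z + 2 * u) % (2 * N n)) (L n * (2 * u)) ⟨
  ((Z + 2 * u) % (2 * N n) % N n + L n * (2 * u)) % N n
      ≡⟨ cong (λ v → (v + L n * (2 * u)) % N n) (m∣n⇒o%n%m≡o%m (N n) (2 * N n) (Z + 2 * u) (n∣m*n 2)) ⟩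
  ((Z + 2 * u) % N n + L n * (2 * u)) % N n              ≡⟨ [a%m+b]%m≡[a+b]%m (Z + 2 * u) (L n * (2 * u)) ⟩
  (Z + 2 * u + L n * (2 * u)) % N n                      ≡⟨ %-≡-by-multiples 0 (2 * u) (lemma Z u (L n)) ⟩
  Z % N n                                                ≡⟨ m<n⇒m%n≡m Z<N ⟩
  Z                                                      ∎)
  where
  open ≡-Reasoning
  lemma : ∀ Z u l → Z + 2 * u + l * (2 * u) + 0 * suc l ≡ Z + 2 * u * suc l
  lemma = solve-∀

foldedPos-relative : ∀ n u₁ u₂ p {y} → y ≤ n → UpToHalfTurn n (offset n u₁ u₂) y →
  foldedPos n u₂ p ≡ cdist n (2 * y) (foldedPos n u₁ p)
foldedPos-relative n u₁ u₂ p {y} y≤n r≈y = begin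
  (p + L n * (2 * u₂)) % N n                  ≡⟨ %-≡-by-multiples 0 (2 * L n * u₁) (lemma p u₁ u₂ (L n)) ⟨
  (p + L n * (2 * u₁) + L n * (2 * t)) % N n  ≡⟨ [a%m+b]%m≡[a+b]%m (p + L n * (2 * u₁)) (L n * (2 * t)) ⟨
  (Z + L n * (2 * t)) % N n                   ≡⟨ [a+c*[b%m]]%m≡[a+c*b]%m Z (L n) (2 * t) ⟨
  (Z + L n * ((2 * t) % N n)) % N n           ≡⟨ cong (λ v → (Z + L n * v) % N n) (2y≈2r r≈y) ⟨
  (Z + L n * ((2 * y) % N n)) % N n           ≡⟨ [a+c*[b%m]]%m≡[a+c*b]%m Z (L n) (2 * y) ⟩
  (Z + L n * (2 * y)) % N n                   ≡⟨ cdist-% n (2 * y) Z ⟨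
  cdist n ((2 * y) % N n) (Z % N n)           ≡⟨ cong₂ (cdist n) (m<n⇒m%n≡m 2y<N) (m%n%n≡m%n (p + L n * (2 * u₁)) (N n)) ⟩
  cdist n (2 * y) Z                           ∎
  where
  open ≡-Reasoning
  t = u₂ + L n * u₁
  Z = foldedPos n u₁ p
  2y<N : 2 * y < N n
  2y<N = ≤-<-trans (*-monoʳ-≤ 2 y≤n) (2n<N n)
  lemma : ∀ p u₁ u₂ l → p + l * (2 * u₁) + l * (2 * (u₂ + l * u₁)) + 0 * suc l ≡ p + l * (2 * u₂) + 2 * l * u₁ * suc l
  lemma = solve-∀
  2y≈2r : UpToHalfTurn n (offset n u₁ u₂) y → (2 * y) % N n ≡ (2 * t) % N n
  2y≈2r (inj₁ r≡y)     = trans (cong (λ v → (2 * v) % N n) (sym r≡y)) ([a+c*[b%m]]%m≡[a+c*b]%m 0 2 t)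
  2y≈2r (inj₂ r≡y+1+n) = begin
    (2 * y) % N n               ≡⟨ [m+n]%n≡m%n (2 * y) (N n) ⟨
    (2 * y + N n) % N n         ≡⟨ cong (_% N n) (lemma′ y n) ⟩
    (2 * (y + suc n)) % N n     ≡⟨ cong (λ v → (2 * v) % N n) r≡y+1+n ⟨
    (2 * offset n u₁ u₂) % N n  ≡⟨ [a+c*[b%m]]%m≡[a+c*b]%m 0 2 t ⟩
    (2 * t) % N n               ∎
    where
    lemma′ : ∀ y n → 2 * y + (2 + 2 * n) ≡ 2 * (y + suc n)
    lemma′ = solve-∀

FoldedArc : ℕ → ℕ → ℕ → ℕ → Set
FoldedArc n s b Z = cdist n s Z ≤ 2 * b

FoldedArc-≥ : ∀ n {s} b {Z} → s ≤ Z → Z < N n → FoldedArc n s b Z ⇔ Z ≤ s + 2 * b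
FoldedArc-≥ n {s} b {Z} s≤Z Z<N =
  ⇔-trans (≡⇒ (cong (_≤ 2 * b) (cdist-≤ n s≤Z Z<N))) (mk⇔ (m∸n≤o⇒m≤n+o s) (m≤n+o⇒m∸n≤o Z s))

FoldedArc-< : ∀ n {s} b {Z} → Z < s → FoldedArc n s b Z ⇔ Z + N n ≤ s + 2 * b
FoldedArc-< n {s} b {Z} Z<s =
  ⇔-trans (≡⇒ (cong (_≤ 2 * b) (cdist-> n Z<s))) (mk⇔ (m∸n≤o⇒m≤n+o s) (m≤n+o⇒m∸n≤o (Z + N n) s))

FoldedArc-start : ∀ n {s} b → s < N n → FoldedArc n s b s
FoldedArc-start n {s} b s<N = from (FoldedArc-≥ n b ≤-refl s<N) (m≤m+n s (2 * b))

folded-laminar : ∀ n {a b y} → b ≤ n → ¬ OverlapsEnd a b y → ¬ OverlapsStart n a b y →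
  Laminar (N n) (_≤ 2 * a) (FoldedArc n (2 * y) b)
folded-laminar n {a} {b} {zero} _ _ _ with a ≤? b
... | yes a≤b = inj₁ (inj₁ λ Z Z<N Z≤2a → from (FoldedArc-≥ n b z≤n Z<N) (≤-trans Z≤2a (*-monoʳ-≤ 2 a≤b)))
... | no  a≰b = inj₁ (inj₂ λ Z Z<N TZ → ≤-trans (to (FoldedArc-≥ n b z≤n Z<N) TZ) (*-monoʳ-≤ 2 (<⇒≤ (≰⇒> a≰b))))
folded-laminar n {a} {b} {y@(suc _)} b≤n ¬end ¬start with y ≤? a
... | yes y≤a = inj₁ (inj₂ T⊆S)
  where
  y+b≤a : y + b ≤ a
  y+b≤a = ≮⇒≥ λ a<y+b → ¬end (z<s , y≤a , a<y+b)
  T⊆S : FoldedArc n (2 * y) b ⊆⟨ N n ⟩ (_≤ 2 * a)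
  T⊆S Z Z<N TZ with 2 * y ≤? Z
  ... | yes 2y≤Z = ≤-trans (to (FoldedArc-≥ n b 2y≤Z Z<N) TZ) (double-≤ y b y+b≤a)
  ... | no  2y≰Z = ≤-trans (<⇒≤ (≰⇒> 2y≰Z)) (*-monoʳ-≤ 2 y≤a)
... | no y≰a with y + b ≤? n
...   | yes y+b≤n = inj₂ λ Z Z<N Z≤2a TZ →
          contradiction (≤-trans (m≤n+m (N n) Z) (≤-trans (to (FoldedArc-< n b (Z<2y Z≤2a)) TZ) (double-≤ y b y+b≤n)))
                        (<⇒≱ (2n<N n))
  where
  Z<2y : ∀ {Z} → Z ≤ 2 * a → Z < 2 * y
  Z<2y Z≤2a = ≤-<-trans Z≤2a (*-monoʳ-< 2 (≰⇒> y≰a))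
...   | no  y+b≰n = inj₁ (inj₁ λ Z Z<N Z≤2a → from (FoldedArc-< n b (Z<2y Z≤2a)) (begin
          Z + N n              ≤⟨ +-monoˡ-≤ (N n) Z≤2a ⟩
          2 * a + N n          ≡⟨ lemma a n ⟩
          2 * suc (n + a)      ≤⟨ *-monoʳ-≤ 2 n+a<y+b ⟩
          2 * (y + b)          ≡⟨ *-distribˡ-+ 2 y b ⟩
          2 * y + 2 * b        ∎))
  where
  open ≤-Reasoning
  Z<2y : ∀ {Z} → Z ≤ 2 * a → Z < 2 * y
  Z<2y Z≤2a = ≤-<-trans Z≤2a (*-monoʳ-< 2 (≰⇒> y≰a))
  n+a<y+b : n + a < y + b
  n+a<y+b = ≰⇒> λ y+b≤n+a → ¬start (≰⇒> y+b≰n , y+b≤n+a)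
  lemma : ∀ a n → 2 * a + (2 + 2 * n) ≡ 2 * suc (n + a)
  lemma = solve-∀

overlapping-end : ∀ n {a b y} → a ≤ n → b ≤ n → OverlapsEnd a b y →
  Overlapping (N n) (_≤ 2 * a) (FoldedArc n (2 * y) b)
overlapping-end n {a} {b} {suc y′} a≤n b≤n (_ , y≤a , a<y+b) =
  (2 * y , 2y<N , 2y≤2a , FoldedArc-start n b 2y<N) ,
  (pred (2 * y) , <-trans ≤-refl 2y<N , ≤-trans (n≤1+n _) 2y≤2a , ¬T-before) ,
  (suc (2 * a) , s≤s (s≤s (*-monoʳ-≤ 2 a≤n)) , 1+n≰n , T-after)
  where
  y = suc y′
  2y≤2a : 2 * y ≤ 2 * a
  2y≤2a = *-monoʳ-≤ 2 y≤a
  2y<N : 2 * y < N n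
  2y<N = ≤-<-trans (*-monoʳ-≤ 2 (≤-trans y≤a a≤n)) (2n<N n)
  ¬T-before : ¬ FoldedArc n (2 * y) b (pred (2 * y))
  ¬T-before T = contradiction
    (+-cancelˡ-≤ (2 * y) _ _ (subst (_≤ 2 * y + 2 * b) (+-suc (pred (2 * y)) (suc (2 * n))) (to (FoldedArc-< n b ≤-refl) T)))
    (<⇒≱ (s≤s (*-monoʳ-≤ 2 b≤n)))
  T-after : FoldedArc n (2 * y) b (suc (2 * a))
  T-after = from (FoldedArc-≥ n b (≤-trans 2y≤2a (n≤1+n _)) (s≤s (s≤s (*-monoʳ-≤ 2 a≤n))))
              (≤-trans (s≤s (+-monoʳ-≤ a (n≤1+n _))) (subst (2 * suc a ≤_) (*-distribˡ-+ 2 y b) (*-monoʳ-≤ 2 a<y+b)))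

overlapping-start : ∀ n {a b y} → b ≤ n → y ≤ n → a < y → OverlapsStart n a b y →
  Overlapping (N n) (_≤ 2 * a) (FoldedArc n (2 * y) b)
overlapping-start n {a} {b} {y} b≤n y≤n a<y (n<y+b , y+b≤n+a) =
  (0 , z<s , z≤n , from (FoldedArc-< n b 0<2y) N≤2y+2b) ,
  (Z , <-trans Z<2y 2y<N , Z≤2a , λ T → 1+n≰n (subst (_≤ 2 * y + 2 * b) Z+N≡1+2y+2b (to (FoldedArc-< n b Z<2y) T))) ,
  (2 * y , 2y<N , (λ 2y≤2a → <⇒≱ a<y (*-cancelˡ-≤ 2 2y≤2a)) , FoldedArc-start n b 2y<N)
  where
  open ≤-Reasoning
  2y<N : 2 * y < N n
  2y<N = ≤-<-trans (*-monoʳ-≤ 2 y≤n) (2n<N n)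
  0<2y : 0 < 2 * y
  0<2y = *-monoʳ-< 2 (≤-<-trans z≤n a<y)
  N≤2y+2b : N n ≤ 2 * y + 2 * b
  N≤2y+2b = begin
    N n            ≡⟨ lemma n ⟩
    2 * suc n      ≤⟨ *-monoʳ-≤ 2 n<y+b ⟩
    2 * (y + b)    ≡⟨ *-distribˡ-+ 2 y b ⟩
    2 * y + 2 * b  ∎
    where
    lemma : ∀ n → 2 + 2 * n ≡ 2 * suc n
    lemma = solve-∀
  Z = suc (2 * y + 2 * b) ∸ N n
  Z+N≡1+2y+2b : Z + N n ≡ suc (2 * y + 2 * b)
  Z+N≡1+2y+2b = m∸n+n≡m (m≤n⇒m≤1+n N≤2y+2b)
  Z<2y : Z < 2 * y
  Z<2y = +-cancelʳ-< (N n) Z (2 * y) (begin-strict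
    Z + N n                  ≡⟨ Z+N≡1+2y+2b ⟩
    suc (2 * y + 2 * b)      ≡⟨ +-suc (2 * y) (2 * b) ⟨
    2 * y + suc (2 * b)      <⟨ +-monoʳ-< (2 * y) (s≤s (s≤s (*-monoʳ-≤ 2 b≤n))) ⟩
    2 * y + N n              ∎)
  Z≤2a : Z ≤ 2 * a
  Z≤2a = +-cancelʳ-≤ (N n) Z (2 * a) (begin
    Z + N n                  ≡⟨ Z+N≡1+2y+2b ⟩
    suc (2 * y + 2 * b)      ≤⟨ s≤s (double-≤ y b y+b≤n+a) ⟩
    suc (2 * (n + a))        ≤⟨ n≤1+n _ ⟩
    2 + 2 * (n + a)          ≡⟨ lemma n a ⟩
    2 * a + N n              ∎)
    where
    lemma : ∀ n a → 2 + 2 * (n + a) ≡ 2 * a + (2 + 2 * n)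
    lemma = solve-∀

folded-overlapping : ∀ n {a b y} → a ≤ n → b ≤ n → y ≤ n → OverlapsEnd a b y ⊎ OverlapsStart n a b y →
  Overlapping (N n) (_≤ 2 * a) (FoldedArc n (2 * y) b)
folded-overlapping n a≤n b≤n y≤n (inj₁ end) = overlapping-end n a≤n b≤n end
folded-overlapping n {a} {b} {y} a≤n b≤n y≤n (inj₂ start@(n<y+b , _)) with y ≤? a
... | yes y≤a = overlapping-end n a≤n b≤n (OverlapsStart⇒0<y b≤n start , y≤a , ≤-<-trans a≤n n<y+b)
... | no  y≰a = overlapping-start n b≤n y≤n (≰⇒> y≰a) start

corollary4p4 : ∀ (n : ℕ) → 1 ≤ n →
    ∀ (u₁ d₁ u₂ d₂ : ℕ) → u₁ < N n → u₂ < N n →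
    2 ≤ d₁ → d₁ ≤ suc n → 2 ≤ d₂ → d₂ ≤ suc n →
    (¬ BCross n u₁ d₁ u₂ d₂) ⇔
      (Nested n (ArcSet n u₁ d₁) (ArcSet n u₂ d₂) ⊎ Disjoint n (ArcSet n u₁ d₁) (ArcSet n u₂ d₂))
corollary4p4 n _ u₁ (suc a) u₂ (suc b) _ _ _ 1+a≤1+n _ 1+b≤1+n
  with half-turn-decomposition n (m%n<n (u₂ + L n * u₁) (N n))
... | y , y≤n , r≈y = mk⇔
  (λ ¬cross → Laminar-pullback ζ S⇔ T⇔ (λ p → m%n<n (p + L n * (2 * u₁)) (N n))
                (folded-laminar n b≤n (¬cross ∘ from crossing ∘ inj₁) (¬cross ∘ from crossing ∘ inj₂)))
  (λ laminar cross → Overlapping⇒¬Laminar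
                (Overlapping-pullback ζ S⇔ T⇔ (foldedPos-surjective n u₁) (folded-overlapping n a≤n b≤n y≤n (to crossing cross)))
                laminar)
  where
  a≤n = s≤s⁻¹ 1+a≤1+n
  b≤n = s≤s⁻¹ 1+b≤1+n
  crossing = BCross⇔Overlaps n u₁ u₂ a≤n b≤n y≤n r≈y
  ζ = foldedPos n u₁
  S⇔ : ∀ p → ArcSet n u₁ (suc a) p ⇔ ζ p ≤ 2 * a
  S⇔ p = ArcSet⇔foldedPos≤ n u₁ p 1+a≤1+n
  T⇔ : ∀ p → ArcSet n u₂ (suc b) p ⇔ FoldedArc n (2 * y) b (ζ p)
  T⇔ p = ⇔-trans (ArcSet⇔foldedPos≤ n u₂ p 1+b≤1+n) (≡⇒ (cong (_≤ 2 * b) (foldedPos-relative n u₁ u₂ p y≤n r≈y)))
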